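{- We have $S_F(0)=1$ and $S_F(1)=2$. Any integer $n\ge 2$ can be written as $F(\ell)+r$ for some $\ell\ge 1$ and $0\le r<F(\ell-1)$, and then $$S_F(F(\ell)+r)=\begin{cases} S_F(F(\ell-1)+r)+S_F(r), & \text{if } 0\le r<F(\ell-2);\\ 2S_F(r), & \text{if } F(\ell-2)\le r<F(\ell-1).\end{cases}$$
   Context: Let $(F(n))_{n\ge 0}$ be defined by $F(0)=1$, $F(1)=2$ and $F(n+2)=F(n+1)+F(n)$, and set $F(-1)=1$. For $n\ge 1$, $\mathrm{rep}_F(n)$ denotes the greedy (Zeckendorf) representation of $n$: the word $c_{\ell-1}\cdots c_0$ over $\{0,1\}$ with $c_{\ell-1}=1$, no two consecutive $1$'s, and $n=\sum_j c_jF(j)$; $\mathrm{rep}_F(0)=\varepsilon$. Let $L_F=\{\varepsilon\}\cup 1\{0,01\}^*$ be the set of these representations. For finite words $u,v$, $\binom{u}{v}$ is the number of occurrences of $v$ as a (scattered) subword (subsequence) of $u$. Define $S_F(n)=\#\{v\in L_F : \binom{\mathrm{rep}_F(n)}{v}>0\}$. -}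

module Defs where

open import Data.Nat using (ℕ; zero; suc; _+_; _∸_; _≤ᵇ_)
open import Data.Bool using (Bool; true; false; if_then_else_; _∧_)
open import Data.List using (List; []; _∷_; length; filter; concatMap; map; upTo; reverse; applyUpTo; sum)
open import Data.Bool.Properties using () renaming (_≟_ to _≟ᵇ_)
open import Relation.Nullary.Decidable using (does)
open import Relation.Binary.PropositionalEquality using (_≡_)

-- Words over {0,1}: false = 0, true = 1; the head of the list is the
-- most significant (leftmost) letter.
Word : Set
Word = List Bool

F : ℕ → ℕ
F zero = 1
F (suc zero) = 2
F (suc (suc n)) = F (suc n) + F n

-- Fm1 k = F(k-1), with the convention F(-1) = 1.
Fm1 : ℕ → ℕ
Fm1 zero = 1
Fm1 (suc k) = F k

-- Length of rep_F(n): the number of j with F(j) ≤ n (F is increasing and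
-- F(j) > j, so all such j are < n).
repLen : ℕ → ℕ
repLen n = length (filter (λ j → F j Data.Nat.≤? n) (upTo n))

greedy : ℕ → ℕ → Word
greedy zero m = []
greedy (suc j) m =
  if F j ≤ᵇ m then true ∷ greedy j (m ∸ F j) else false ∷ greedy j m

repF : ℕ → Word
repF n = greedy (repLen n) n

tailOK : Word → Bool
tailOK [] = true
tailOK (false ∷ true ∷ w) = tailOK w
tailOK (false ∷ w) = tailOK w
tailOK (true ∷ w) = false

-- Membership in L_F = {ε} ∪ 1{0,01}^*
inLF : Word → Bool
inLF [] = true
inLF (true ∷ w) = tailOK w
inLF (false ∷ w) = false

-- Binomial coefficient of words: number of occurrences of v as a
-- scattered subword of u.
binom : Word → Word → ℕ
binom u [] = 1
binom [] (b ∷ v) = 0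
binom (a ∷ u) (b ∷ v) =
  binom u (b ∷ v) + (if does (a ≟ᵇ b) then binom u v else 0)

wordsOfLen : ℕ → List Word
wordsOfLen zero = [] ∷ []
wordsOfLen (suc k) = concatMap (λ w → (false ∷ w) ∷ (true ∷ w) ∷ []) (wordsOfLen k)

wordsUpTo : ℕ → List Word
wordsUpTo m = concatMap wordsOfLen (upTo (suc m))

-- S_F(n) = #{ v ∈ L_F : binom(rep_F(n), v) > 0 }.
-- Any v with binom(u, v) > 0 has |v| ≤ |u|, so it suffices to range over
-- words of length at most |rep_F(n)|.
SF : ℕ → ℕ
SF n = length (filter (λ v → (inLF v ∧ (1 ≤ᵇ binom (repF n) v)) ≟ᵇ true)
                      (wordsUpTo (length (repF n))))

-- A word of L_F occurring in u is ε or a 1 followed by a word of {0,01}^*, and a word of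
-- {0,01}^* is ε or a 0 followed by a word of {0,01}^* or of L_F. Embedding subwords
-- leftmost, this yields a recursion on u for the number of occurring words of either kind.
-- Since rep_F(F(k+1) + r) = 10 w, with w the k-digit greedy expansion of r, the two cases
-- of the proposition are w = 0w' and w = 1w', where the recursion gives
-- S(100w') = S(10w') + S(w') and S(101w') = 2 S(1w'); leading zeros do not change S.
module Submission where

open import Defs
open import Data.Nat using (ℕ; suc; _+_; _*_; _≤_; _<_)
open import Data.Product using (_×_; ∃-syntax)
open import Relation.Binary.PropositionalEquality using (_≡_)

open import Algebra.Properties.CommutativeSemigroup using (interchange)
open import Data.Bool using (Bool; true; false; if_then_else_; _∧_)
open import Data.Bool.Properties using (∧-zeroʳ) renaming (_≟_ to _≟ᵇ_)
open import Data.List using (List; []; _∷_; _++_; length; filter; concatMap; map; upTo; applyUpTo)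
open import Data.List.Properties using (concatMap-++; map-upTo; filter-accept; filter-reject)
open import Data.Nat using (zero; _∸_; _≤ᵇ_; z≤n; s≤s; z<s; s<s; _≤?_; _<?_)
open import Data.Nat.Properties
open import Data.Nat.Tactic.RingSolver using (solve-∀)
open import Data.Product using (_,_; proj₁; proj₂)
open import Data.Sum using (inj₁; inj₂)
open import Function using (id; _∘_)
open import Relation.Nullary using (does; yes; no; contradiction)
open import Relation.Unary using (Pred; Decidable)
open import Relation.Binary.PropositionalEquality
  using (refl; sym; trans; cong; cong₂; subst; _≗_; module ≡-Reasoning)

open ≡-Reasoning

indicator : Bool → ℕ
indicator true  = 1
indicator false = 0

count : (Word → Bool) → List Word → ℕ
count P xs = length (filter (λ v → P v ≟ᵇ true) xs)

count-∷ : ∀ P x xs → count P (x ∷ xs) ≡ indicator (P x) + count P xs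
count-∷ P x xs with P x
... | true  = refl
... | false = refl

extend : Word → List Word
extend w = (false ∷ w) ∷ (true ∷ w) ∷ []

count-extend : ∀ P xs →
  count P (concatMap extend xs) ≡ count (P ∘ (false ∷_)) xs + count (P ∘ (true ∷_)) xs
count-extend P [] = refl
count-extend P (x ∷ xs) = begin
  count P ((false ∷ x) ∷ (true ∷ x) ∷ concatMap extend xs)
    ≡⟨ trans (count-∷ P _ _) (cong (a +_) (count-∷ P _ _)) ⟩
  a + (b + count P (concatMap extend xs))
    ≡⟨ cong (λ n → a + (b + n)) (count-extend P xs) ⟩
  a + (b + (count P₀ xs + count P₁ xs))
    ≡⟨ sym (+-assoc a b _) ⟩
  a + b + (count P₀ xs + count P₁ xs)
    ≡⟨ interchange +-commutativeSemigroup a b _ _ ⟩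
  (a + count P₀ xs) + (b + count P₁ xs)
    ≡⟨ sym (cong₂ _+_ (count-∷ P₀ x xs) (count-∷ P₁ x xs)) ⟩
  count P₀ (x ∷ xs) + count P₁ (x ∷ xs) ∎
  where
  P₀ P₁ : Word → Bool
  P₀ = P ∘ (false ∷_)
  P₁ = P ∘ (true ∷_)
  a b : ℕ
  a = indicator (P₀ x)
  b = indicator (P₁ x)

wordsOfLen-map-suc : ∀ ks →
  concatMap wordsOfLen (map suc ks) ≡ concatMap extend (concatMap wordsOfLen ks)
wordsOfLen-map-suc [] = refl
wordsOfLen-map-suc (k ∷ ks) = begin
  wordsOfLen (suc k) ++ concatMap wordsOfLen (map suc ks)
    ≡⟨ cong (wordsOfLen (suc k) ++_) (wordsOfLen-map-suc ks) ⟩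
  concatMap extend (wordsOfLen k) ++ concatMap extend (concatMap wordsOfLen ks)
    ≡⟨ sym (concatMap-++ extend (wordsOfLen k) _) ⟩
  concatMap extend (wordsOfLen k ++ concatMap wordsOfLen ks) ∎

wordsUpTo-suc : ∀ m → wordsUpTo (suc m) ≡ [] ∷ concatMap extend (wordsUpTo m)
wordsUpTo-suc m = cong ([] ∷_) (begin
  concatMap wordsOfLen (applyUpTo suc (suc m))
    ≡⟨ cong (concatMap wordsOfLen) (sym (map-upTo suc (suc m))) ⟩
  concatMap wordsOfLen (map suc (upTo (suc m)))
    ≡⟨ wordsOfLen-map-suc (upTo (suc m)) ⟩
  concatMap extend (wordsUpTo m) ∎)

countUpTo : (Word → Bool) → ℕ → ℕ
countUpTo P zero    = indicator (P [])
countUpTo P (suc m) =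
  indicator (P []) + countUpTo (P ∘ (false ∷_)) m + countUpTo (P ∘ (true ∷_)) m

count-wordsUpTo : ∀ P m → count P (wordsUpTo m) ≡ countUpTo P m
count-wordsUpTo P zero = trans (count-∷ P [] []) (+-identityʳ _)
count-wordsUpTo P (suc m) = begin
  count P (wordsUpTo (suc m))
    ≡⟨ cong (count P) (wordsUpTo-suc m) ⟩
  count P ([] ∷ concatMap extend (wordsUpTo m))
    ≡⟨ count-∷ P [] _ ⟩
  indicator (P []) + count P (concatMap extend (wordsUpTo m))
    ≡⟨ cong (indicator (P []) +_) (count-extend P (wordsUpTo m)) ⟩
  indicator (P []) + (count (P ∘ (false ∷_)) (wordsUpTo m) + count (P ∘ (true ∷_)) (wordsUpTo m))
    ≡⟨ sym (+-assoc (indicator (P [])) _ _) ⟩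
  indicator (P []) + count (P ∘ (false ∷_)) (wordsUpTo m) + count (P ∘ (true ∷_)) (wordsUpTo m)
    ≡⟨ cong₂ (λ x y → indicator (P []) + x + y) (count-wordsUpTo _ m) (count-wordsUpTo _ m) ⟩
  countUpTo P (suc m) ∎

countUpTo-cong : ∀ {P Q} → P ≗ Q → ∀ m → countUpTo P m ≡ countUpTo Q m
countUpTo-cong P≗Q zero = cong indicator (P≗Q [])
countUpTo-cong P≗Q (suc m) =
  cong₂ _+_ (cong₂ _+_ (cong indicator (P≗Q []))
                       (countUpTo-cong (P≗Q ∘ (false ∷_)) m))
            (countUpTo-cong (P≗Q ∘ (true ∷_)) m)

countUpTo-none : ∀ {P} → (∀ v → P v ≡ false) → ∀ m → countUpTo P m ≡ 0
countUpTo-none P≡false zero = cong indicator (P≡false [])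
countUpTo-none P≡false (suc m) =
  cong₂ _+_ (cong₂ _+_ (cong indicator (P≡false []))
                       (countUpTo-none (P≡false ∘ (false ∷_)) m))
            (countUpTo-none (P≡false ∘ (true ∷_)) m)

countUpTo-only-[] : ∀ {P} → (∀ b w → P (b ∷ w) ≡ false) → ∀ m → countUpTo P m ≡ indicator (P [])
countUpTo-only-[] _ zero = refl
countUpTo-only-[] {P} P∷≡false (suc m) = begin
  indicator (P []) + countUpTo (P ∘ (false ∷_)) m + countUpTo (P ∘ (true ∷_)) m
    ≡⟨ cong₂ (λ x y → indicator (P []) + x + y)
             (countUpTo-none (P∷≡false false) m) (countUpTo-none (P∷≡false true) m) ⟩
  indicator (P []) + 0 + 0
    ≡⟨ trans (+-identityʳ _) (+-identityʳ _) ⟩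
  indicator (P []) ∎

_⊑ᵇ_ : Word → Word → Bool
[]      ⊑ᵇ u       = true
(b ∷ v) ⊑ᵇ []      = false
(b ∷ v) ⊑ᵇ (a ∷ u) = if does (a ≟ᵇ b) then v ⊑ᵇ u else (b ∷ v) ⊑ᵇ u

binom-∷ˡ-≤ : ∀ a u v → binom u v ≤ binom (a ∷ u) v
binom-∷ˡ-≤ a u []      = ≤-refl
binom-∷ˡ-≤ a u (b ∷ v) = m≤m+n _ _

binom-∷ʳ-positive : ∀ u b v → 0 < binom u (b ∷ v) → 0 < binom u v
binom-∷ʳ-positive [] b v ()
binom-∷ʳ-positive (a ∷ u) b v p with binom u (b ∷ v) in eq | does (a ≟ᵇ b)
... | suc _ | _ =
  ≤-trans (binom-∷ʳ-positive u b v (subst (0 <_) (sym eq) z<s)) (binom-∷ˡ-≤ a u v)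
... | zero  | true = ≤-trans p (binom-∷ˡ-≤ a u v)
binom-∷ʳ-positive (a ∷ u) b v () | zero | false

1≤ᵇ+-absorbˡ : ∀ {x y} → (0 < x → 0 < y) → (1 ≤ᵇ x + y) ≡ (1 ≤ᵇ y)
1≤ᵇ+-absorbˡ {zero}          _ = refl
1≤ᵇ+-absorbˡ {suc x} {suc y} _ = refl
1≤ᵇ+-absorbˡ {suc x} {zero}  x>0⇒y>0 with () ← x>0⇒y>0 z<s

1≤ᵇbinom≡⊑ᵇ : ∀ u v → (1 ≤ᵇ binom u v) ≡ v ⊑ᵇ u
1≤ᵇbinom≡⊑ᵇ u       []      = refl
1≤ᵇbinom≡⊑ᵇ []      (b ∷ v) = refl
1≤ᵇbinom≡⊑ᵇ (a ∷ u) (b ∷ v) with a ≟ᵇ b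
... | yes refl = trans (1≤ᵇ+-absorbˡ (binom-∷ʳ-positive u b v)) (1≤ᵇbinom≡⊑ᵇ u v)
... | no _     = trans (cong (1 ≤ᵇ_) (+-identityʳ (binom u (b ∷ v)))) (1≤ᵇbinom≡⊑ᵇ u (b ∷ v))

countLF countTail : Word → ℕ → ℕ
countLF   u = countUpTo (λ v → inLF v ∧ v ⊑ᵇ u)
countTail u = countUpTo (λ v → tailOK v ∧ v ⊑ᵇ u)

lfSubwords tailSubwords : Word → ℕ
lfSubwords []          = 1
lfSubwords (false ∷ u) = lfSubwords u
lfSubwords (true ∷ u)  = suc (tailSubwords u)
tailSubwords []          = 1
tailSubwords (false ∷ u) = tailSubwords u + lfSubwords u
tailSubwords (true ∷ u)  = tailSubwords u

countLF-[] : ∀ m → countLF [] m ≡ 1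
countLF-[] = countUpTo-only-[] (λ b w → ∧-zeroʳ (inLF (b ∷ w)))

countTail-[] : ∀ m → countTail [] m ≡ 1
countTail-[] = countUpTo-only-[] (λ b w → ∧-zeroʳ (tailOK (b ∷ w)))

countLF-0∷ : ∀ u m → countLF (false ∷ u) m ≡ countLF u m
countLF-0∷ u = countUpTo-cong same
  where
  same : ∀ v → (inLF v ∧ v ⊑ᵇ (false ∷ u)) ≡ (inLF v ∧ v ⊑ᵇ u)
  same []          = refl
  same (false ∷ w) = refl
  same (true ∷ w)  = refl

countLF-1∷ : ∀ u m → countLF (true ∷ u) (suc m) ≡ suc (countTail u m)
countLF-1∷ u m = cong (λ n → suc (n + countTail u m)) (countUpTo-none (λ _ → refl) m)

countTail-1∷ : ∀ u m → countTail (true ∷ u) m ≡ countTail u m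
countTail-1∷ u = countUpTo-cong same
  where
  same : ∀ v → (tailOK v ∧ v ⊑ᵇ (true ∷ u)) ≡ (tailOK v ∧ v ⊑ᵇ u)
  same []          = refl
  same (false ∷ w) = refl
  same (true ∷ w)  = refl

-- The words of {0,01}^* beginning with 0 are 0 followed by a word of {0,01}^* or of L_F,
-- these two languages sharing only ε.
countTail-0∷ : ∀ u m → countTail (false ∷ u) (suc m) ≡ countTail u m + countLF u m
countTail-0∷ u zero = refl
countTail-0∷ u (suc m) = begin
  2 + x + y + countUpTo (λ _ → false) (suc m)
    ≡⟨ cong (2 + x + y +_) (countUpTo-none (λ _ → refl) (suc m)) ⟩
  2 + x + y + 0
    ≡⟨ rearrange x y ⟩
  (1 + x + 0) + (1 + 0 + y)
    ≡⟨ sym (cong₂ (λ s t → (1 + x + s) + (1 + t + y)) none none) ⟩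
  countTail u (suc m) + countLF u (suc m) ∎
  where
  x y : ℕ
  x = countUpTo (λ w → tailOK (false ∷ w) ∧ (false ∷ w) ⊑ᵇ u) m
  y = countUpTo (λ w → tailOK w ∧ (true ∷ w) ⊑ᵇ u) m
  none : countUpTo (λ _ → false) m ≡ 0
  none = countUpTo-none (λ _ → refl) m
  rearrange : ∀ x y → 2 + x + y + 0 ≡ (1 + x + 0) + (1 + 0 + y)
  rearrange = solve-∀

subword-counts : ∀ u {m} → length u ≤ m →
  countLF u m ≡ lfSubwords u × countTail u m ≡ tailSubwords u
subword-counts [] {m} _ = countLF-[] m , countTail-[] m
subword-counts (false ∷ u) {suc m} (s≤s |u|≤m) =
  trans (countLF-0∷ u (suc m)) (proj₁ (subword-counts u (m≤n⇒m≤1+n |u|≤m))) ,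
  trans (countTail-0∷ u m) (cong₂ _+_ (proj₂ IH) (proj₁ IH))
  where
  IH : countLF u m ≡ lfSubwords u × countTail u m ≡ tailSubwords u
  IH = subword-counts u |u|≤m
subword-counts (true ∷ u) {suc m} (s≤s |u|≤m) =
  trans (countLF-1∷ u m) (cong suc (proj₂ (subword-counts u |u|≤m))) ,
  trans (countTail-1∷ u (suc m)) (proj₂ (subword-counts u (m≤n⇒m≤1+n |u|≤m)))

SF≡lfSubwords : ∀ n → SF n ≡ lfSubwords (repF n)
SF≡lfSubwords n = begin
  SF n
    ≡⟨ count-wordsUpTo _ m ⟩
  countUpTo (λ v → inLF v ∧ (1 ≤ᵇ binom u v)) m
    ≡⟨ countUpTo-cong (λ v → cong (inLF v ∧_) (1≤ᵇbinom≡⊑ᵇ u v)) m ⟩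
  countLF u m
    ≡⟨ proj₁ (subword-counts u ≤-refl) ⟩
  lfSubwords u ∎
  where
  u : Word
  u = repF n
  m : ℕ
  m = length u

lfSubwords-100 : ∀ w →
  lfSubwords (true ∷ false ∷ false ∷ w) ≡ lfSubwords (true ∷ false ∷ w) + lfSubwords w
lfSubwords-100 w = refl

lfSubwords-101 : ∀ w → lfSubwords (true ∷ false ∷ true ∷ w) ≡ 2 * lfSubwords (true ∷ w)
lfSubwords-101 w = cong (λ n → suc (tailSubwords w + n)) (sym (+-identityʳ _))

0<F : ∀ j → 0 < F j
0<F zero          = z<s
0<F (suc zero)    = z<s
0<F (suc (suc j)) = <-≤-trans (0<F (suc j)) (m≤m+n _ _)

F<F-suc : ∀ j → F j < F (suc j)
F<F-suc zero    = s<s z<s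
F<F-suc (suc j) = m<m+n (F (suc j)) (0<F j)

F-mono-≤ : ∀ {i j} → i ≤ j → F i ≤ F j
F-mono-≤ {j = zero} z≤n = ≤-refl
F-mono-≤ {j = suc j} i≤1+j with m≤n⇒m<n∨m≡n i≤1+j
... | inj₁ (s≤s i≤j) = ≤-trans (F-mono-≤ i≤j) (<⇒≤ (F<F-suc j))
... | inj₂ refl      = ≤-refl

n<F[n] : ∀ n → n < F n
n<F[n] zero    = z<s
n<F[n] (suc n) = ≤-trans (s≤s (n<F[n] n)) (F<F-suc n)

F-bracket : ∀ n → ∃[ i ] (F i ≤ suc n × suc n < F (suc i))
F-bracket zero = 0 , s≤s z≤n , s<s z<s
F-bracket (suc n) with F-bracket n
... | i , lo , hi with suc (suc n) <? F (suc i)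
...   | yes hi′ = i , m≤n⇒m≤1+n lo , hi′
...   | no ¬hi′ = suc i , ≤-reflexive F≡n+2 , subst (_< F (suc (suc i))) F≡n+2 (F<F-suc (suc i))
  where
  F≡n+2 : F (suc i) ≡ suc (suc n)
  F≡n+2 = ≤-antisym (≮⇒≥ ¬hi′) hi

F-decompose : ∀ n → 2 ≤ n → ∃[ k ] ∃[ r ] (r < F k × n ≡ F (suc k) + r)
F-decompose (suc n) 2≤n with F-bracket n
... | zero  , _  , hi = contradiction hi (≤⇒≯ 2≤n)
... | suc k , lo , hi = k , suc n ∸ F (suc k) , r<Fk , sym (m+[n∸m]≡n lo)
  where
  r<Fk : suc n ∸ F (suc k) < F k
  r<Fk = +-cancelˡ-< (F (suc k)) _ _ (subst (_< F (suc k) + F k) (sym (m+[n∸m]≡n lo)) hi)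

length-filter-applyUpTo : ∀ {a p} {A : Set a} {P : Pred A p} (P? : Decidable P) (f : ℕ → A) {k n} →
  k ≤ n → (∀ {i} → i < k → P (f i)) → (∀ {i} → P (f i) → i < k) →
  length (filter P? (applyUpTo f n)) ≡ k
length-filter-applyUpTo P? f {zero} {zero} _ _ _ = refl
length-filter-applyUpTo P? f {zero} {suc n} _ _ only = trans
  (cong length (filter-reject P? (λ p → n≮0 (only p))))
  (length-filter-applyUpTo P? (f ∘ suc) {n = n} z≤n (λ ()) (λ p → contradiction (only p) n≮0))
length-filter-applyUpTo P? f {suc k} {suc n} (s≤s k≤n) below only = trans
  (cong length (filter-accept P? (below z<s)))
  (cong suc (length-filter-applyUpTo P? (f ∘ suc) k≤n (λ i<k → below (s<s i<k)) (λ p → ≤-pred (only p))))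

repF-bracket : ∀ i {n} → F i ≤ n → n < F (suc i) → repF n ≡ greedy (suc i) n
repF-bracket i {n} lo hi = cong (λ ℓ → greedy ℓ n) repLen≡1+i
  where
  repLen≡1+i : repLen n ≡ suc i
  repLen≡1+i = length-filter-applyUpTo (λ j → F j ≤? n) id (≤-trans (n<F[n] i) lo)
    (λ j<1+i → ≤-trans (F-mono-≤ (≤-pred j<1+i)) lo)
    (λ Fj≤n → ≰⇒> (λ 1+i≤j → <⇒≱ (<-≤-trans hi (F-mono-≤ 1+i≤j)) Fj≤n))

greedy-≥ : ∀ j {m} → F j ≤ m → greedy (suc j) m ≡ true ∷ greedy j (m ∸ F j)
greedy-≥ j {m} Fj≤m with F j ≤ᵇ m | ≤⇒≤ᵇ Fj≤m
... | true  | _ = refl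
... | false | ()

greedy-< : ∀ j {m} → m < F j → greedy (suc j) m ≡ false ∷ greedy j m
greedy-< j {m} m<Fj with F j ≤ᵇ m | ≤ᵇ⇒≤ (F j) m
... | false | _    = refl
... | true  | Fj≤m = contradiction (Fj≤m _) (<⇒≱ m<Fj)

repF-F+ : ∀ k {r} → r < F k → repF (F (suc k) + r) ≡ true ∷ false ∷ greedy k r
repF-F+ k {r} r<Fk = begin
  repF (F (suc k) + r)
    ≡⟨ repF-bracket (suc k) (m≤m+n (F (suc k)) r) (+-monoʳ-< (F (suc k)) r<Fk) ⟩
  greedy (suc (suc k)) (F (suc k) + r)
    ≡⟨ greedy-≥ (suc k) (m≤m+n (F (suc k)) r) ⟩
  true ∷ greedy (suc k) (F (suc k) + r ∸ F (suc k))
    ≡⟨ cong (λ m → true ∷ greedy (suc k) m) (m+n∸m≡n (F (suc k)) r) ⟩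
  true ∷ greedy (suc k) r
    ≡⟨ cong (true ∷_) (greedy-< k r<Fk) ⟩
  true ∷ false ∷ greedy k r ∎

-- greedy j r is rep_F(r) padded with leading zeros, which lfSubwords ignores.
SF-greedy : ∀ j {r} → r < F j → SF r ≡ lfSubwords (greedy j r)
SF-greedy zero    {zero}  _ = refl
SF-greedy zero    {suc r} (s≤s ())
SF-greedy (suc i) {r}     r<F with r <? F i
... | yes r<Fi = trans (SF-greedy i r<Fi) (cong lfSubwords (sym (greedy-< i r<Fi)))
... | no  r≮Fi = trans (SF≡lfSubwords r) (cong lfSubwords (repF-bracket i (≮⇒≥ r≮Fi) r<F))

SF-F+ : ∀ k {r} → r < F k → SF (F (suc k) + r) ≡ lfSubwords (true ∷ false ∷ greedy k r)
SF-F+ k {r} r<Fk = trans (SF≡lfSubwords (F (suc k) + r)) (cong lfSubwords (repF-F+ k r<Fk))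

SF-F+-below : ∀ k {r} → r < F k → r < Fm1 k → SF (F (suc k) + r) ≡ SF (F k + r) + SF r
SF-F+-below zero    {zero}  _ _ = refl
SF-F+-below zero    {suc r} (s≤s ()) _
SF-F+-below (suc j) {r} r<F r<Fj = begin
  SF (F (suc (suc j)) + r)
    ≡⟨ SF-F+ (suc j) r<F ⟩
  lfSubwords (true ∷ false ∷ greedy (suc j) r)
    ≡⟨ cong (λ w → lfSubwords (true ∷ false ∷ w)) (greedy-< j r<Fj) ⟩
  lfSubwords (true ∷ false ∷ false ∷ greedy j r)
    ≡⟨ lfSubwords-100 (greedy j r) ⟩
  lfSubwords (true ∷ false ∷ greedy j r) + lfSubwords (greedy j r)
    ≡⟨ sym (cong₂ _+_ (SF-F+ j r<Fj) (SF-greedy j r<Fj)) ⟩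
  SF (F (suc j) + r) + SF r ∎

SF-F+-above : ∀ k {r} → r < F k → Fm1 k ≤ r → SF (F (suc k) + r) ≡ 2 * SF r
SF-F+-above zero r<1 1≤r = contradiction 1≤r (<⇒≱ r<1)
SF-F+-above (suc j) {r} r<F Fj≤r = begin
  SF (F (suc (suc j)) + r)
    ≡⟨ SF-F+ (suc j) r<F ⟩
  lfSubwords (true ∷ false ∷ greedy (suc j) r)
    ≡⟨ cong (λ w → lfSubwords (true ∷ false ∷ w)) (greedy-≥ j Fj≤r) ⟩
  lfSubwords (true ∷ false ∷ true ∷ greedy j (r ∸ F j))
    ≡⟨ lfSubwords-101 (greedy j (r ∸ F j)) ⟩
  2 * lfSubwords (true ∷ greedy j (r ∸ F j))
    ≡⟨ cong (λ w → 2 * lfSubwords w) (sym (greedy-≥ j Fj≤r)) ⟩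
  2 * lfSubwords (greedy (suc j) r)
    ≡⟨ cong (2 *_) (sym (SF-greedy (suc j) r<F)) ⟩
  2 * SF r ∎

proposition8p3 :
    (SF 0 ≡ 1) × (SF 1 ≡ 2)
    × (∀ n → 2 ≤ n → ∃[ k ] ∃[ r ] (r < F k × n ≡ F (suc k) + r))
    × (∀ k r → r < F k →
        (r < Fm1 k → SF (F (suc k) + r) ≡ SF (F k + r) + SF r)
        × (Fm1 k ≤ r → SF (F (suc k) + r) ≡ 2 * SF r))
proposition8p3 =
  refl , refl , F-decompose , λ k r r<Fk → SF-F+-below k r<Fk , SF-F+-above k r<Fk
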